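{- Let $\mathcal P$ be any set of formulas and $A,B$ formulas. (1) If $\vdash_{\mathcal P} ;A\vee B$, then $\vdash_{\mathcal P} ;A$ or $\vdash_{\mathcal P} A;$ or $\vdash_{\mathcal P} ;B$ or $\vdash_{\mathcal P} B;$. (2) If $A\notin\mathcal P$, $B\notin\mathcal P$ and $\vdash_{\mathcal P} ;A\vee B$, then $\vdash_{\mathcal P} ;A$ or $\vdash_{\mathcal P} ;B$. (Here $\vdash_{\mathcal P} ;F$ means the $\mathcal P$-sequent with empty left side, empty body and stoup $F$ is derivable, and $\vdash_{\mathcal P} F;$ means the $\mathcal P$-sequent with empty left side, body $F$ and empty stoup is derivable.)
   Context: Formulas are given by the grammar $F ::= 0 \mid \perp \mid X \mid F\wedge F \mid F\vee F \mid F\rightarrow F$, where $X$ ranges over a set $\mathcal V$ of propositional variables and $0$, $\perp$ are two distinct constants. Fix an arbitrary set $\mathcal P$ of formulas. A $\mathcal P$-sequent is an expression $\Gamma\vdash\Delta;\Pi$ where $\Gamma,\Delta,\Pi$ are finite multisets of formulas, every formula of $\Delta$ (the body) belongs to $\mathcal P$, and $\Pi$ (the stoup) contains at most one formula. The system $\mathrm{ML}_{\mathcal P}$ derives $\mathcal P$-sequents with the following rules (below $C$ denotes a single formula, $\Pi$ a stoup with at most one formula, and all sequents must be $\mathcal P$-sequents): Axiom/cuts: $ax$: $A\vdash ;A$. $cut_1$: from $\Gamma\vdash\Delta;A$ and $\Gamma',A\vdash\Delta';\Pi$ infer $\Gamma,\Gamma'\vdash\Delta,\Delta';\Pi$. $cut_2$: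 from $\Gamma\vdash\Delta,A;\Pi$ and $\Gamma',A\vdash\Delta';$ infer $\Gamma,\Gamma'\vdash\Delta,\Delta';\Pi$. Structure: $der$: from $\Gamma\vdash\Delta;A$ with $A\in\mathcal P$ infer $\Gamma\vdash\Delta,A;$. $c_l$: from $\Gamma,A,A\vdash\Delta;\Pi$ infer $\Gamma,A\vdash\Delta;\Pi$. $c_r$: from $\Gamma\vdash\Delta,A,A;\Pi$ infer $\Gamma\vdash\Delta,A;\Pi$. $w_l$: from $\Gamma\vdash\Delta;\Pi$ infer $\Gamma,A\vdash\Delta;\Pi$. $w_r$: from $\Gamma\vdash\Delta;\Pi$ with $A\in\mathcal P$ infer $\Gamma\vdash\Delta,A;\Pi$. Logic: $0$: $\Gamma,0\vdash\Delta;\Pi$ (any $\Delta\subseteq\mathcal P$). $\perp$: $\perp\vdash ;$. $\wedge^1_l$: from $\Gamma,A,B\vdash\Delta;C$ with $A\notin\mathcal P$ and $B\notin\mathcal P$ infer $\Gamma,A\wedge B\vdash\Delta;C$. $\wedge^2_l$: from $\Gamma,A,B\vdash\Delta;$ infer $\Gamma,A\wedge B\vdash\Delta;$. $\wedge^1_r$: from $\Gamma\vdash\Delta;A$ and $\Gamma'\vdash\Delta';B$ infer $\Gamma,\Gamma'\vdash\Delta,\Delta';A\wedge B$. $\wedge^2_r$: from $\Gamma\vdash\Delta,A;$ and $\Gamma'\vdash\Delta',B;$ infer the same conclusion. $\wedge^3_r$: from $\Gamma\vdash\Delta;A$ and $\Gamma'\vdash\Delta',B;$ infer the same conclusion. $\wedge^4_r$: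 from $\Gamma\vdash\Delta,A;$ and $\Gamma'\vdash\Delta';B$ infer the same conclusion. $\vee^1_l$: from $\Gamma,A\vdash\Delta;C$ and $\Gamma,B\vdash\Delta;C$ with $A\notin\mathcal P$ and $B\notin\mathcal P$ infer $\Gamma,A\vee B\vdash\Delta;C$. $\vee^2_l$: from $\Gamma,A\vdash\Delta;$ and $\Gamma,B\vdash\Delta;$ infer $\Gamma,A\vee B\vdash\Delta;$. $\vee^1_r$: from $\Gamma\vdash\Delta;A$ infer $\Gamma\vdash\Delta;A\vee B$. $\vee^2_r$: from $\Gamma\vdash\Delta;B$ infer $\Gamma\vdash\Delta;A\vee B$. $\vee^3_r$: from $\Gamma\vdash\Delta,A;$ infer $\Gamma\vdash\Delta;A\vee B$. $\vee^4_r$: from $\Gamma\vdash\Delta,B;$ infer $\Gamma\vdash\Delta;A\vee B$. $\rightarrow^1_l$: from $\Gamma,B\vdash\Delta;C$ and $\Gamma'\vdash\Delta';A$ with $B\notin\mathcal P$ infer $\Gamma,\Gamma',A\rightarrow B\vdash\Delta,\Delta';C$. $\rightarrow^2_l$: from $\Gamma,B\vdash\Delta;$ and $\Gamma'\vdash\Delta';A$ infer $\Gamma,\Gamma',A\rightarrow B\vdash\Delta,\Delta';$. $\rightarrow^3_l$: from $\Gamma,B\vdash\Delta;$ and $\Gamma'\vdash\Delta',A;\Pi$ infer $\Gamma,\Gamma',A\rightarrow B\vdash\Delta,\Delta';\Pi$. $\rightarrow^1_r$: from $\Gamma,A\vdash\Delta;B$ infer $\Gamma\vdash\Delta;A\rightarrow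 B$. $\rightarrow^2_r$: from $\Gamma,A\vdash\Delta,B;$ infer $\Gamma\vdash\Delta;A\rightarrow B$. One writes $\Gamma\vdash_{\mathcal P}\Delta;\Pi$ when the $\mathcal P$-sequent $\Gamma\vdash\Delta;\Pi$ is derivable in $\mathrm{ML}_{\mathcal P}$. -}

module Defs where

open import Data.List using (List; []; _∷_; _++_; [_])
open import Data.List.Relation.Unary.All using (All)
open import Data.List.Relation.Binary.Permutation.Propositional using (_↭_)
open import Data.Maybe using (Maybe; just; nothing)
open import Relation.Nullary using (¬_)

-- Formulas over a set V of propositional variables.
-- zero' is the constant 0, bot is ⊥.
data Formula (V : Set) : Set where
  zero' : Formula V
  bot   : Formula V
  var   : V → Formula V
  _∧'_  : Formula V → Formula V → Formula V
  _∨'_  : Formula V → Formula V → Formula V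
  _⇒'_  : Formula V → Formula V → Formula V

infixr 6 _∧'_
infixr 5 _∨'_
infixr 4 _⇒'_

-- Derivability in ML_P of the P-sequent  Γ ⊢ Δ ; Π.
-- Multisets are represented by lists, identified up to permutation via
-- the rule 'perm'.  The P-sequent condition
-- (all body formulas in P) is enforced by the side conditions on the only
-- rules that introduce body formulas (der, w_r, the 0 axiom); all other
-- rules preserve it.
module _ {V : Set} (P : Formula V → Set) where

  data ML : List (Formula V) → List (Formula V) → Maybe (Formula V) → Set where
    perm  : ∀ {Γ Γ' Δ Δ' Π} → Γ ↭ Γ' → Δ ↭ Δ' → ML Γ Δ Π → ML Γ' Δ' Π
    ax    : ∀ {A} → ML [ A ] [] (just A)
    cut₁  : ∀ {Γ Γ' Δ Δ' A Π} → ML Γ Δ (just A) → ML (A ∷ Γ') Δ' Π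
          → ML (Γ ++ Γ') (Δ ++ Δ') Π
    cut₂  : ∀ {Γ Γ' Δ Δ' A Π} → ML Γ (A ∷ Δ) Π → ML (A ∷ Γ') Δ' nothing
          → ML (Γ ++ Γ') (Δ ++ Δ') Π
    der   : ∀ {Γ Δ A} → P A → ML Γ Δ (just A) → ML Γ (A ∷ Δ) nothing
    cₗ    : ∀ {Γ Δ A Π} → ML (A ∷ A ∷ Γ) Δ Π → ML (A ∷ Γ) Δ Π
    cᵣ    : ∀ {Γ Δ A Π} → ML Γ (A ∷ A ∷ Δ) Π → ML Γ (A ∷ Δ) Π
    wₗ    : ∀ {Γ Δ A Π} → ML Γ Δ Π → ML (A ∷ Γ) Δ Π
    wᵣ    : ∀ {Γ Δ A Π} → P A → ML Γ Δ Π → ML Γ (A ∷ Δ) Π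
    zeroL : ∀ {Γ Δ Π} → All P Δ → ML (zero' ∷ Γ) Δ Π
    botL  : ML [ bot ] [] nothing
    ∧¹ₗ   : ∀ {Γ Δ A B C} → ¬ P A → ¬ P B → ML (A ∷ B ∷ Γ) Δ (just C)
          → ML ((A ∧' B) ∷ Γ) Δ (just C)
    ∧²ₗ   : ∀ {Γ Δ A B} → ML (A ∷ B ∷ Γ) Δ nothing → ML ((A ∧' B) ∷ Γ) Δ nothing
    ∧¹ᵣ   : ∀ {Γ Γ' Δ Δ' A B} → ML Γ Δ (just A) → ML Γ' Δ' (just B)
          → ML (Γ ++ Γ') (Δ ++ Δ') (just (A ∧' B))
    ∧²ᵣ   : ∀ {Γ Γ' Δ Δ' A B} → ML Γ (A ∷ Δ) nothing → ML Γ' (B ∷ Δ') nothing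
          → ML (Γ ++ Γ') (Δ ++ Δ') (just (A ∧' B))
    ∧³ᵣ   : ∀ {Γ Γ' Δ Δ' A B} → ML Γ Δ (just A) → ML Γ' (B ∷ Δ') nothing
          → ML (Γ ++ Γ') (Δ ++ Δ') (just (A ∧' B))
    ∧⁴ᵣ   : ∀ {Γ Γ' Δ Δ' A B} → ML Γ (A ∷ Δ) nothing → ML Γ' Δ' (just B)
          → ML (Γ ++ Γ') (Δ ++ Δ') (just (A ∧' B))
    ∨¹ₗ   : ∀ {Γ Δ A B C} → ¬ P A → ¬ P B → ML (A ∷ Γ) Δ (just C) → ML (B ∷ Γ) Δ (just C)
          → ML ((A ∨' B) ∷ Γ) Δ (just C)
    ∨²ₗ   : ∀ {Γ Δ A B} → ML (A ∷ Γ) Δ nothing → ML (B ∷ Γ) Δ nothing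
          → ML ((A ∨' B) ∷ Γ) Δ nothing
    ∨¹ᵣ   : ∀ {Γ Δ A B} → ML Γ Δ (just A) → ML Γ Δ (just (A ∨' B))
    ∨²ᵣ   : ∀ {Γ Δ A B} → ML Γ Δ (just B) → ML Γ Δ (just (A ∨' B))
    ∨³ᵣ   : ∀ {Γ Δ A B} → ML Γ (A ∷ Δ) nothing → ML Γ Δ (just (A ∨' B))
    ∨⁴ᵣ   : ∀ {Γ Δ A B} → ML Γ (B ∷ Δ) nothing → ML Γ Δ (just (A ∨' B))
    ⇒¹ₗ   : ∀ {Γ Γ' Δ Δ' A B C} → ¬ P B → ML (B ∷ Γ) Δ (just C) → ML Γ' Δ' (just A)
          → ML ((A ⇒' B) ∷ Γ ++ Γ') (Δ ++ Δ') (just C)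
    ⇒²ₗ   : ∀ {Γ Γ' Δ Δ' A B} → ML (B ∷ Γ) Δ nothing → ML Γ' Δ' (just A)
          → ML ((A ⇒' B) ∷ Γ ++ Γ') (Δ ++ Δ') nothing
    ⇒³ₗ   : ∀ {Γ Γ' Δ Δ' A B Π} → ML (B ∷ Γ) Δ nothing → ML Γ' (A ∷ Δ') Π
          → ML ((A ⇒' B) ∷ Γ ++ Γ') (Δ ++ Δ') Π
    ⇒¹ᵣ   : ∀ {Γ Δ A B} → ML (A ∷ Γ) Δ (just B) → ML Γ Δ (just (A ⇒' B))
    ⇒²ᵣ   : ∀ {Γ Δ A B} → ML (A ∷ Γ) (B ∷ Δ) nothing → ML Γ Δ (just (A ⇒' B))

module Submission where

open import Defs
open import Data.List using ([]; _∷_; _++_; [_])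
open import Data.List.Properties using (++-identityʳ)
open import Data.List.Relation.Unary.All using (All; []; _∷_; head; tail) renaming (map to All-map)
open import Data.List.Relation.Unary.All.Properties using (++⁻; ++⁺)
open import Data.List.Relation.Binary.Permutation.Propositional using (↭-refl; ↭-sym; ↭-reflexive; ↭-swap)
open import Data.List.Relation.Binary.Permutation.Propositional.Properties using (All-resp-↭; shift)
open import Data.Maybe using (Maybe; just; nothing)
open import Data.Product using (_×_; _,_; proj₁; proj₂)
open import Data.Sum using (_⊎_; inj₁; inj₂)
open import Data.Empty using (⊥; ⊥-elim)
open import Data.Unit using (⊤)
open import Relation.Nullary using (¬_)

-- A glueing argument, with no cut elimination.  By recursion on formulas,
-- a value of A is a closed derivation of  ⊢ ;A  together with semantic
-- content: for A ∨ B, a value of A or of B or a closed body derivation of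
-- A or of B.  A covalue of D is a derivation of  D ⊢ ;  that turns every
-- value of D into a derivation of the empty sequent.  Every rule of ML_P
-- maps values of the left side and covalues of the body to a value of the
-- stoup (cuts are absorbed because only closed derivations are stored), so
-- a derivation of  ⊢ ;A ∨ B  yields a value of A ∨ B, whose content is one
-- of the four disjuncts.  Body derivations only exist for formulas of P.

module _ {V : Set} (P : Formula V → Set) where

  body-in-P : ∀ {Γ Δ Π} → ML P Γ Δ Π → All P Δ
  body-in-P (perm _ q d) = All-resp-↭ q (body-in-P d)
  body-in-P ax           = []
  body-in-P (cut₁ d e)   = ++⁺ (body-in-P d) (body-in-P e)
  body-in-P (cut₂ d e)   = ++⁺ (tail (body-in-P d)) (body-in-P e)
  body-in-P (der p d)    = p ∷ body-in-P d
  body-in-P (cₗ d)       = body-in-P d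
  body-in-P (cᵣ d)       = tail (body-in-P d)
  body-in-P (wₗ d)       = body-in-P d
  body-in-P (wᵣ p d)     = p ∷ body-in-P d
  body-in-P (zeroL ps)   = ps
  body-in-P botL         = []
  body-in-P (∧¹ₗ _ _ d)  = body-in-P d
  body-in-P (∧²ₗ d)      = body-in-P d
  body-in-P (∧¹ᵣ d e)    = ++⁺ (body-in-P d) (body-in-P e)
  body-in-P (∧²ᵣ d e)    = ++⁺ (tail (body-in-P d)) (tail (body-in-P e))
  body-in-P (∧³ᵣ d e)    = ++⁺ (body-in-P d) (tail (body-in-P e))
  body-in-P (∧⁴ᵣ d e)    = ++⁺ (tail (body-in-P d)) (body-in-P e)
  body-in-P (∨¹ₗ _ _ d _) = body-in-P d
  body-in-P (∨²ₗ d _)    = body-in-P d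
  body-in-P (∨¹ᵣ d)      = body-in-P d
  body-in-P (∨²ᵣ d)      = body-in-P d
  body-in-P (∨³ᵣ d)      = tail (body-in-P d)
  body-in-P (∨⁴ᵣ d)      = tail (body-in-P d)
  body-in-P (⇒¹ₗ _ d e)  = ++⁺ (body-in-P d) (body-in-P e)
  body-in-P (⇒²ₗ d e)    = ++⁺ (body-in-P d) (body-in-P e)
  body-in-P (⇒³ₗ d e)    = ++⁺ (body-in-P d) (tail (body-in-P e))
  body-in-P (⇒¹ᵣ d)      = body-in-P d
  body-in-P (⇒²ᵣ d)      = tail (body-in-P d)

  ⊢∅ : Set
  ⊢∅ = ML P [] [] nothing

  cut-left : ∀ Θ {Γ Δ Π} → ML P (Θ ++ Γ) Δ Π → All (λ G → ML P [] [] (just G)) Γ → ML P Θ Δ Π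
  cut-left Θ {[]} d [] rewrite ++-identityʳ Θ = d
  cut-left Θ {G ∷ Γ} d (c ∷ cs) = cut-left Θ (cut₁ c (perm (shift G Θ Γ) ↭-refl d)) cs

  cut-body : ∀ Ξ {Θ Δ Π} → ML P Θ (Ξ ++ Δ) Π → All (λ D → ML P [ D ] [] nothing) Δ → ML P Θ Ξ Π
  cut-body Ξ {Θ} {[]} d [] = perm ↭-refl (↭-reflexive (++-identityʳ Ξ)) d
  cut-body Ξ {Θ} {D ∷ Δ} d (c ∷ cs) =
    cut-body Ξ (perm (↭-reflexive (++-identityʳ Θ)) (↭-reflexive (++-identityʳ (Ξ ++ Δ)))
      (cut₂ (perm ↭-refl (shift D Ξ Δ) d) c)) cs

  mutual
    ⟦_⟧ : Formula V → Set
    ⟦ zero' ⟧  = ⊥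
    ⟦ bot ⟧    = ⊤
    ⟦ var _ ⟧  = ⊤
    ⟦ A ∧' B ⟧ = Result A × Result B
    ⟦ A ∨' B ⟧ = Value A ⊎ BodyValue A ⊎ Value B ⊎ BodyValue B
    ⟦ A ⇒' B ⟧ = Value A → Result B

    Value : Formula V → Set
    Value A = ML P [] [] (just A) × ⟦ A ⟧

    Covalue : Formula V → Set
    Covalue D = ML P [ D ] [] nothing × (Value D → ⊢∅)

    BodyValue : Formula V → Set
    BodyValue A = ML P [] [ A ] nothing × (Covalue A → ⊢∅)

    Result : Formula V → Set
    Result A = Value A ⊎ BodyValue A

  StoupValue : Maybe (Formula V) → Set
  StoupValue nothing  = ⊢∅
  StoupValue (just A) = Value A

  cut-values : ∀ Θ Ξ {Γ Δ Π} → ML P (Θ ++ Γ) (Ξ ++ Δ) Π → All Value Γ → All Covalue Δ → ML P Θ Ξ Π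
  cut-values Θ Ξ d vs cs = cut-body Ξ (cut-left Θ d (All-map proj₁ vs)) (All-map proj₁ cs)

  bodyValue-in-P : ∀ {A} → BodyValue A → P A
  bodyValue-in-P (d , _) = head (body-in-P d)

  result-value : ∀ {A} → ¬ P A → Result A → Value A
  result-value _   (inj₁ v) = v
  result-value ¬pA (inj₂ b) = ⊥-elim (¬pA (bodyValue-in-P b))

  refute : ∀ {A} → Result A → Covalue A → ⊢∅
  refute (inj₁ v)       (_ , k) = k v
  refute (inj₂ (_ , k)) c       = k c

  cut-result : ∀ {B Γ Δ} → Result B → ML P (B ∷ Γ) Δ nothing → ML P Γ Δ nothing
  cut-result (inj₁ (d , _)) e = cut₁ d e
  cut-result (inj₂ (d , _)) e = cut₂ d e

  mutual
    covalue : ∀ {D Γ Δ} → ML P (D ∷ Γ) Δ nothing → All Value Γ → All Covalue Δ → Covalue D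
    covalue d vs cs = cut-values [ _ ] [] d vs cs , λ v → adequacy d (v ∷ vs) cs

    bodyValue : ∀ {A Γ Δ} → ML P Γ (A ∷ Δ) nothing → All Value Γ → All Covalue Δ → BodyValue A
    bodyValue d vs cs = cut-values [] [ _ ] d vs cs , λ c → adequacy d vs (c ∷ cs)

    value : ∀ {A Γ Δ} → ML P Γ Δ (just A) → All Value Γ → All Covalue Δ → ⟦ A ⟧ → Value A
    value d vs cs a = cut-values [] [] d vs cs , a

    adequacy : ∀ {Γ Δ Π} → ML P Γ Δ Π → All Value Γ → All Covalue Δ → StoupValue Π
    adequacy (perm p q d) vs cs = adequacy d (All-resp-↭ (↭-sym p) vs) (All-resp-↭ (↭-sym q) cs)
    adequacy ax (v ∷ []) [] = v
    adequacy (cut₁ {Γ} {Δ = Δ} d e) vs cs with ++⁻ Γ vs | ++⁻ Δ cs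
    ... | vs₁ , vs₂ | cs₁ , cs₂ = adequacy e (adequacy d vs₁ cs₁ ∷ vs₂) cs₂
    adequacy (cut₂ {Γ} {Δ = Δ} d e) vs cs with ++⁻ Γ vs | ++⁻ Δ cs
    ... | vs₁ , vs₂ | cs₁ , cs₂ = adequacy d vs₁ (covalue e vs₂ cs₂ ∷ cs₁)
    adequacy (der _ d) vs ((_ , k) ∷ cs) = k (adequacy d vs cs)
    adequacy (cₗ d) (v ∷ vs) cs = adequacy d (v ∷ v ∷ vs) cs
    adequacy (cᵣ d) vs (c ∷ cs) = adequacy d vs (c ∷ c ∷ cs)
    adequacy (wₗ d) (_ ∷ vs) cs = adequacy d vs cs
    adequacy (wᵣ _ d) vs (_ ∷ cs) = adequacy d vs cs
    adequacy (zeroL _) ((_ , ()) ∷ _) _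
    adequacy botL ((d , _) ∷ []) [] = cut₁ d botL
    adequacy (∧¹ₗ ¬pA ¬pB d) ((_ , (a , b)) ∷ vs) cs =
      adequacy d (result-value ¬pA a ∷ result-value ¬pB b ∷ vs) cs
    adequacy (∧²ₗ {A = A} {B} d) ((_ , (a , b)) ∷ vs) cs =
      refute a (cut-values [ A ] [] (cut-result b d′) vs cs , λ va →
        refute b (cut-values [ B ] [] d′ (va ∷ vs) cs , λ vb → adequacy d (va ∷ vb ∷ vs) cs))
      where
      d′ = perm (↭-swap A B ↭-refl) ↭-refl d
    adequacy d@(∧¹ᵣ {Γ} {Δ = Δ} d₁ d₂) vs cs with ++⁻ Γ vs | ++⁻ Δ cs
    ... | vs₁ , vs₂ | cs₁ , cs₂ = value d vs cs (inj₁ (adequacy d₁ vs₁ cs₁) , inj₁ (adequacy d₂ vs₂ cs₂))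
    adequacy d@(∧²ᵣ {Γ} {Δ = Δ} d₁ d₂) vs cs with ++⁻ Γ vs | ++⁻ Δ cs
    ... | vs₁ , vs₂ | cs₁ , cs₂ = value d vs cs (inj₂ (bodyValue d₁ vs₁ cs₁) , inj₂ (bodyValue d₂ vs₂ cs₂))
    adequacy d@(∧³ᵣ {Γ} {Δ = Δ} d₁ d₂) vs cs with ++⁻ Γ vs | ++⁻ Δ cs
    ... | vs₁ , vs₂ | cs₁ , cs₂ = value d vs cs (inj₁ (adequacy d₁ vs₁ cs₁) , inj₂ (bodyValue d₂ vs₂ cs₂))
    adequacy d@(∧⁴ᵣ {Γ} {Δ = Δ} d₁ d₂) vs cs with ++⁻ Γ vs | ++⁻ Δ cs
    ... | vs₁ , vs₂ | cs₁ , cs₂ = value d vs cs (inj₂ (bodyValue d₁ vs₁ cs₁) , inj₁ (adequacy d₂ vs₂ cs₂))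
    adequacy (∨¹ₗ _ _ d _) ((_ , inj₁ a) ∷ vs) cs = adequacy d (a ∷ vs) cs
    adequacy (∨¹ₗ ¬pA _ _ _) ((_ , inj₂ (inj₁ a)) ∷ _) _ = ⊥-elim (¬pA (bodyValue-in-P a))
    adequacy (∨¹ₗ _ _ _ e) ((_ , inj₂ (inj₂ (inj₁ b))) ∷ vs) cs = adequacy e (b ∷ vs) cs
    adequacy (∨¹ₗ _ ¬pB _ _) ((_ , inj₂ (inj₂ (inj₂ b))) ∷ _) _ = ⊥-elim (¬pB (bodyValue-in-P b))
    adequacy (∨²ₗ d _) ((_ , inj₁ a) ∷ vs) cs = adequacy d (a ∷ vs) cs
    adequacy (∨²ₗ d _) ((_ , inj₂ (inj₁ a)) ∷ vs) cs = refute (inj₂ a) (covalue d vs cs)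
    adequacy (∨²ₗ _ e) ((_ , inj₂ (inj₂ (inj₁ b))) ∷ vs) cs = adequacy e (b ∷ vs) cs
    adequacy (∨²ₗ _ e) ((_ , inj₂ (inj₂ (inj₂ b))) ∷ vs) cs = refute (inj₂ b) (covalue e vs cs)
    adequacy d@(∨¹ᵣ d₁) vs cs = value d vs cs (inj₁ (adequacy d₁ vs cs))
    adequacy d@(∨²ᵣ d₁) vs cs = value d vs cs (inj₂ (inj₂ (inj₁ (adequacy d₁ vs cs))))
    adequacy d@(∨³ᵣ d₁) vs cs = value d vs cs (inj₂ (inj₁ (bodyValue d₁ vs cs)))
    adequacy d@(∨⁴ᵣ d₁) vs cs = value d vs cs (inj₂ (inj₂ (inj₂ (bodyValue d₁ vs cs))))
    adequacy (⇒¹ₗ {Γ} {Δ = Δ} ¬pB d e) ((_ , f) ∷ vs) cs with ++⁻ Γ vs | ++⁻ Δ cs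
    ... | vs₁ , vs₂ | cs₁ , cs₂ = adequacy d (result-value ¬pB (f (adequacy e vs₂ cs₂)) ∷ vs₁) cs₁
    adequacy (⇒²ₗ {Γ} {Δ = Δ} d e) ((_ , f) ∷ vs) cs with ++⁻ Γ vs | ++⁻ Δ cs
    ... | vs₁ , vs₂ | cs₁ , cs₂ = refute (f (adequacy e vs₂ cs₂)) (covalue d vs₁ cs₁)
    -- the covalue of A is  A ⊢ ;  obtained by cutting the closed  ⊢ ;A ⇒ B  against  A ⇒ B, A ⊢ ;
    adequacy (⇒³ₗ {Γ} {Δ = Δ} {A = A} d e) ((g , f) ∷ vs) cs with ++⁻ Γ vs | ++⁻ Δ cs
    ... | vs₁ , vs₂ | cs₁ , cs₂ =
      adequacy e vs₂ ((cut₁ g (⇒²ₗ {Γ = []} {Γ' = [ A ]} {Δ = []} {Δ' = []} (proj₁ c) ax)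
                       , λ a → refute (f a) c) ∷ cs₂)
      where
      c = covalue d vs₁ cs₁
    adequacy d@(⇒¹ᵣ d₁) vs cs = value d vs cs (λ a → inj₁ (adequacy d₁ (a ∷ vs) cs))
    adequacy d@(⇒²ᵣ d₁) vs cs = value d vs cs (λ a → inj₂ (bodyValue d₁ (a ∷ vs) cs))

  disjunction-value : ∀ {A B} → ML P [] [] (just (A ∨' B)) → ⟦ A ∨' B ⟧
  disjunction-value d = proj₂ (adequacy d [] [])

corollary3p3 : {V : Set} (P : Formula V → Set) (A B : Formula V)
    → (ML P [] [] (just (A ∨' B))
        → ML P [] [] (just A) ⊎ ML P [] [ A ] nothing ⊎ ML P [] [] (just B) ⊎ ML P [] [ B ] nothing)
    × (¬ P A → ¬ P B → ML P [] [] (just (A ∨' B))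
        → ML P [] [] (just A) ⊎ ML P [] [] (just B))
corollary3p3 P A B = four-cases , two-cases
  where
  four-cases : ML P [] [] (just (A ∨' B))
    → ML P [] [] (just A) ⊎ ML P [] [ A ] nothing ⊎ ML P [] [] (just B) ⊎ ML P [] [ B ] nothing
  four-cases d with disjunction-value P d
  ... | inj₁ (a , _)               = inj₁ a
  ... | inj₂ (inj₁ (a , _))        = inj₂ (inj₁ a)
  ... | inj₂ (inj₂ (inj₁ (b , _))) = inj₂ (inj₂ (inj₁ b))
  ... | inj₂ (inj₂ (inj₂ (b , _))) = inj₂ (inj₂ (inj₂ b))

  two-cases : ¬ P A → ¬ P B → ML P [] [] (just (A ∨' B)) → ML P [] [] (just A) ⊎ ML P [] [] (just B)
  two-cases ¬pA ¬pB d with disjunction-value P d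
  ... | inj₁ (a , _)               = inj₁ a
  ... | inj₂ (inj₁ a)              = ⊥-elim (¬pA (bodyValue-in-P P a))
  ... | inj₂ (inj₂ (inj₁ (b , _))) = inj₂ b
  ... | inj₂ (inj₂ (inj₂ b))       = ⊥-elim (¬pB (bodyValue-in-P P b))
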